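{- Let $G$ and $H$ be connected graphs such that $G_{SR}$ and $H_{SR}$ are regular and at least one of them is bipartite. Then $$\dim_s(G\Box H)=\frac{|\partial(G)|\,|\partial(H)|}{2}.$$
   Context: All graphs are finite and simple. For a connected graph $G$, $d_G$ is the shortest-path distance and $I_G[u,v]$ is the set of vertices on some shortest $u$–$v$ path. A vertex $w$ strongly resolves $u,v$ if $v\in I_G[u,w]$ or $u\in I_G[v,w]$. A strong resolving set is a set $S\subseteq V(G)$ such that every pair of vertices is strongly resolved by some vertex of $S$; $\dim_s(G)$ is the minimum size of one. A vertex $u$ is maximally distant from $v$ if $d_G(v,w)\le d_G(u,v)$ for every neighbor $w$ of $u$; $u,v$ are mutually maximally distant if each is maximally distant from the other. The boundary $\partial(G)$ is the set of vertices $u$ for which some $v$ exists with $u,v$ mutually maximally distant. The strong resolving graph $G_{SR}$ has vertex set $\partial(G)$, two vertices adjacent iff mutually maximally distant in $G$. $G\Box H$ is the Cartesian product: vertex set $V(G)\times V(H)$, $(a,b)\sim(c,d)$ iff ($a=c$ and $bd\in E(H)$) or ($b=d$ and $ac\in E(G)$). -}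

module Defs where

open import Data.Nat using (ℕ; zero; suc; _+_; _*_; _≤_; _<_)
open import Data.Fin using (Fin; remQuot)
open import Data.Fin.Subset using (Subset; _∈_; ∣_∣)
open import Data.Bool using (Bool)
open import Data.Product using (Σ; ∃; _×_; _,_; proj₁; proj₂)
open import Data.Sum using (_⊎_; inj₁; inj₂)
open import Relation.Nullary using (¬_)
open import Relation.Binary.PropositionalEquality using (_≡_; _≢_; refl; sym)
open import Function.Bundles using (_⇔_)
open import Level using (0ℓ)

record Graph : Set₁ where
  field
    n      : ℕ
    Adj    : Fin n → Fin n → Set
    adj-sym : ∀ {u v} → Adj u v → Adj v u
    irrefl : ∀ {u} → ¬ Adj u u
open Graph public

module _ (G : Graph) where

  data Walk : Fin (n G) → Fin (n G) → ℕ → Set where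
    here : ∀ {u} → Walk u u 0
    step : ∀ {u w v k} → Adj G u w → Walk w v k → Walk u v (suc k)

  Connected : Set
  Connected = ∀ u v → ∃ λ k → Walk u v k

  Dist : Fin (n G) → Fin (n G) → ℕ → Set
  Dist u v k = Walk u v k × (∀ m → m < k → ¬ Walk u v m)

  InInterval : Fin (n G) → Fin (n G) → Fin (n G) → Set
  InInterval u v x = ∃ λ a → ∃ λ b → Dist u x a × Dist x v b × Dist u v (a + b)

  StronglyResolves : Fin (n G) → Fin (n G) → Fin (n G) → Set
  StronglyResolves w u v = InInterval u w v ⊎ InInterval v w u

  StrongResolvingSet : Subset (n G) → Set
  StrongResolvingSet S = ∀ u v → ∃ λ w → w ∈ S × StronglyResolves w u v

  IsStrongMetricDim : ℕ → Set
  IsStrongMetricDim k =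
    (∃ λ S → StrongResolvingSet S × ∣ S ∣ ≡ k) ×
    (∀ S → StrongResolvingSet S → k ≤ ∣ S ∣)

  MaxDistantFrom : Fin (n G) → Fin (n G) → Set
  MaxDistantFrom u v = ∀ w → Adj G u w → ∀ a b → Dist v w a → Dist u v b → a ≤ b

  MutuallyMaxDistant : Fin (n G) → Fin (n G) → Set
  MutuallyMaxDistant u v = MaxDistantFrom u v × MaxDistantFrom v u

  InBoundary : Fin (n G) → Set
  InBoundary u = ∃ λ v → MutuallyMaxDistant u v

  IsBoundary : Subset (n G) → Set
  IsBoundary B = ∀ u → (u ∈ B) ⇔ InBoundary u

  -- G_SR: vertex set ∂(G), adjacency = mutual maximal distance
  SRAdj : Fin (n G) → Fin (n G) → Set
  SRAdj u v = InBoundary u × InBoundary v × u ≢ v × MutuallyMaxDistant u v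

  SRRegular : Set
  SRRegular = ∃ λ r → ∀ u → InBoundary u →
    ∃ λ (N : Subset (n G)) → (∀ v → (v ∈ N) ⇔ SRAdj u v) × ∣ N ∣ ≡ r

  SRBipartite : Set
  SRBipartite = ∃ λ (c : Fin (n G) → Bool) → ∀ u v → SRAdj u v → c u ≢ c v

-- Cartesian product G □ H, vertices Fin (n G * n H) ≅ Fin (n G) × Fin (n H) via remQuot
module _ (G H : Graph) where
  PAdj : Fin (n G) × Fin (n H) → Fin (n G) × Fin (n H) → Set
  PAdj (a , b) (c , d) = (a ≡ c × Adj H b d) ⊎ (b ≡ d × Adj G a c)

  PAdj-sym : ∀ {x y} → PAdj x y → PAdj y x
  PAdj-sym (inj₁ (e , h)) = inj₁ (sym e , adj-sym H h)
  PAdj-sym (inj₂ (e , g)) = inj₂ (sym e , adj-sym G g)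

  PAdj-irrefl : ∀ {x} → ¬ PAdj x x
  PAdj-irrefl (inj₁ (_ , h)) = irrefl H h
  PAdj-irrefl (inj₂ (_ , g)) = irrefl G g

_□_ : Graph → Graph → Graph
G □ H = record
  { n = n G * n H
  ; Adj = λ x y → PAdj G H (remQuot (n H) x) (remQuot (n H) y)
  ; adj-sym = PAdj-sym G H
  ; irrefl = PAdj-irrefl G H
  }

-- A set S strongly resolves a connected graph iff it contains an end of every pair of mutually
-- maximally distant vertices, i.e. iff it is a vertex cover of G_SR: a vertex w strongly resolving
-- such a pair x, y lies beyond one of them on a geodesic, and maximality forces it to be that end;
-- conversely, extending a u–v geodesic past v to x and then past u to y yields a mutually maximally
-- distant pair x, y each of which strongly resolves u, v.  Distances in G □ H add up, so
-- (G □ H)_SR is the direct product of G_SR and H_SR, an (r·s)-regular graph on |∂G|·|∂H| vertices.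
-- Counting edges at their covered ends, a vertex cover of an r-regular graph (r ≥ 1) on N vertices
-- has at least N/2 vertices; when the graph is also bipartite both colour classes are covers, so each
-- has exactly N/2 vertices, and a colour class of G_SR times ∂(H) covers (G □ H)_SR.

module Submission where

open import Defs
import Data.Nat as ℕ
open import Data.Nat using (ℕ; zero; suc; _+_; _*_; _≤_; _<_; _≤?_; z≤n; s≤s; NonZero; >-nonZero)
open import Data.Nat.Properties hiding (_≟_)
open import Algebra.Properties.CommutativeSemigroup *-commutativeSemigroup using () renaming (interchange to *-interchange)
open import Algebra.Properties.Semiring.Sum +-*-semiring
  using (sum; sum-cong-≗; sum-replicate-zero; ∑-distrib-+; ∑-comm; *-distribˡ-sum; *-distribʳ-sum)
open import Data.Bool using (Bool; true; false; _∧_; not)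
open import Data.Bool.Properties using (not-injective)
open import Data.Empty using (⊥-elim)
open import Data.Fin using (Fin; zero; suc; fromℕ<; combine; remQuot; _↑ˡ_; _↑ʳ_; _≟_)
open import Data.Fin.Properties using (any?; all?; fromℕ<-injective; remQuot-combine; combine-remQuot)
open import Data.Fin.Subset using (Subset; _∈_; ∣_∣)
open import Data.List using (List; allFin; filter)
open import Data.List.Extrema.Nat using (argmax; argmax-all; f[xs]≤f[argmax])
open import Data.List.Membership.Propositional.Properties using (∈-filter⁺; ∈-allFin)
import Data.List.Relation.Unary.All as All
open import Data.List.Relation.Unary.All.Properties using (all-filter)
open import Data.Product using (∃; ∃₂; _×_; _,_; proj₁; proj₂; swap)
import Data.Sum as Sum
open import Data.Sum using (_⊎_; inj₁; inj₂; [_,_]′)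
open import Data.Vec using ([]; _∷_; lookup; tabulate)
open import Data.Vec.Properties using ([]=⇒lookup; lookup⇒[]=; lookup∘tabulate)
open import Function using (id; _∘_; _∘′_)
open import Function.Bundles using (Equivalence; mk⇔)
open import Relation.Binary.PropositionalEquality
open import Relation.Nullary using (¬_; Dec; yes; no; does; contradiction; ¬¬-excluded-middle)
open import Relation.Nullary.Decidable using (_×-dec_; _⊎-dec_; _→-dec_; does-⇔; dec-true; decidable-stable)
open import Relation.Unary using (Decidable)

𝟙 : Bool → ℕ
𝟙 true  = 1
𝟙 false = 0

count : ∀ {m} → (Fin m → Bool) → ℕ
count P = sum (λ i → 𝟙 (P i))

𝟙-∧ : ∀ a b → 𝟙 (a ∧ b) ≡ 𝟙 a * 𝟙 b
𝟙-∧ true  b = sym (+-identityʳ (𝟙 b))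
𝟙-∧ false b = refl

𝟙≤1 : ∀ b → 𝟙 b ≤ 1
𝟙≤1 true  = ≤-refl
𝟙≤1 false = z≤n

∧-≡true⁻ : ∀ {a b} → a ∧ b ≡ true → a ≡ true × b ≡ true
∧-≡true⁻ {true}  {true}  refl = refl , refl
∧-≡true⁻ {true}  {false} ()
∧-≡true⁻ {false} ()

∧-≡true⁺ : ∀ {a b} → a ≡ true → b ≡ true → a ∧ b ≡ true
∧-≡true⁺ refl refl = refl

does≡true⇒ : ∀ {A : Set} (a? : Dec A) → does a? ≡ true → A
does≡true⇒ (yes a) _  = a
does≡true⇒ (no _)  ()

does-reflects : ∀ {A : Set} (a? : Dec A) {b : Bool} → (A → b ≡ true) → (b ≡ true → A) → does a? ≡ b
does-reflects (yes a) A⇒b b⇒A = sym (A⇒b a)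
does-reflects (no ¬a) {false} A⇒b b⇒A = refl
does-reflects (no ¬a) {true}  A⇒b b⇒A = contradiction (b⇒A refl) ¬a

sum-mono-≤ : ∀ {m} {f g : Fin m → ℕ} → (∀ i → f i ≤ g i) → sum f ≤ sum g
sum-mono-≤ {zero}  _   = z≤n
sum-mono-≤ {suc m} f≤g = +-mono-≤ (f≤g zero) (sum-mono-≤ (f≤g ∘ suc))

term≤sum : ∀ {m} (f : Fin m → ℕ) i → f i ≤ sum f
term≤sum f zero    = m≤m+n _ _
term≤sum f (suc i) = ≤-trans (term≤sum (f ∘ suc) i) (m≤n+m _ _)

sum-↑ : ∀ m {n} (f : Fin (m + n) → ℕ) →
        sum f ≡ sum (λ i → f (i ↑ˡ n)) + sum (λ j → f (m ↑ʳ j))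
sum-↑ zero    f = refl
sum-↑ (suc m) f = trans (cong (f zero +_) (sum-↑ m (f ∘ suc))) (sym (+-assoc (f zero) _ _))

sum-combine : ∀ m {n} (f : Fin (m * n) → ℕ) →
              sum f ≡ sum {m} (λ i → sum {n} (λ j → f (combine i j)))
sum-combine zero        f = refl
sum-combine (suc m) {n} f =
  trans (sum-↑ n f) (cong (sum (λ j → f (j ↑ˡ (m * n))) +_) (sum-combine m (f ∘ (n ↑ʳ_))))

∣p∣≡count-lookup : ∀ {m} (p : Subset m) → ∣ p ∣ ≡ count (lookup p)
∣p∣≡count-lookup []          = refl
∣p∣≡count-lookup (true ∷ p)  = cong suc (∣p∣≡count-lookup p)
∣p∣≡count-lookup (false ∷ p) = ∣p∣≡count-lookup p

count-split : ∀ {m} (P Q : Fin m → Bool) → count P ≡ count (λ i → P i ∧ Q i) + count (λ i → P i ∧ not (Q i))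
count-split P Q = trans (sum-cong-≗ (λ i → split (P i) (Q i)))
                        (∑-distrib-+ (λ i → 𝟙 (P i ∧ Q i)) (λ i → 𝟙 (P i ∧ not (Q i))))
  where
  split : ∀ p q → 𝟙 p ≡ 𝟙 (p ∧ q) + 𝟙 (p ∧ not q)
  split true  true  = refl
  split true  false = refl
  split false q     = refl

balanced-split : ∀ {a b n} → n ≤ 2 * a → n ≤ 2 * b → a + b ≡ n → 2 * a ≡ n
balanced-split {a} {b} {n} n≤2a n≤2b a+b≡n = ≤-antisym (+-cancelʳ-≤ n (2 * a) n 2a+n≤n+n) n≤2a
  where
  open ≤-Reasoning
  2a+n≤n+n : 2 * a + n ≤ n + n
  2a+n≤n+n = begin
    2 * a + n     ≤⟨ +-monoʳ-≤ (2 * a) n≤2b ⟩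
    2 * a + 2 * b ≡⟨ *-distribˡ-+ 2 a b ⟨
    2 * (a + b)   ≡⟨ cong (2 *_) a+b≡n ⟩
    2 * n         ≡⟨ cong (n +_) (+-identityʳ n) ⟩
    n + n         ∎

-- A graph on Fin m given by its adjacency matrix; Regular below describes an r-regular graph
-- on the vertex subset V, all other vertices being isolated.
module BooleanGraph {m} (E : Fin m → Fin m → Bool) (E-sym : ∀ x y → E x y ≡ E y x) where

  degree : Fin m → ℕ
  degree x = count (E x)

  Covers : (Fin m → Bool) → Set
  Covers C = ∀ x y → E x y ≡ true → C x ≡ true ⊎ C y ≡ true

  private
    covered-edge : ∀ e c c′ → (e ≡ true → c ≡ true ⊎ c′ ≡ true) →
                   𝟙 e ≤ 𝟙 c * 𝟙 e + 𝟙 c′ * 𝟙 e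
    covered-edge false c c′ _ = z≤n
    covered-edge true  c c′ cov with cov refl
    ... | inj₁ refl = s≤s z≤n
    ... | inj₂ refl = m≤n+m 1 (𝟙 c * 1)

  -- Every edge is counted once at each end, and at least one end lies in C.
  handshake-cover : ∀ C → Covers C → sum degree ≤ 2 * sum (λ x → 𝟙 (C x) * degree x)
  handshake-cover C cov = begin
    sum (λ x → sum (λ y → 𝟙 (E x y)))
      ≤⟨ sum-mono-≤ (λ x → sum-mono-≤ (λ y → covered-edge (E x y) (C x) (C y) (cov x y))) ⟩
    sum (λ x → sum (λ y → 𝟙 (C x) * 𝟙 (E x y) + 𝟙 (C y) * 𝟙 (E x y)))
      ≡⟨ sum-cong-≗ (λ x → ∑-distrib-+ (λ y → 𝟙 (C x) * 𝟙 (E x y)) (λ y → 𝟙 (C y) * 𝟙 (E x y))) ⟩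
    sum (λ x → sum (λ y → 𝟙 (C x) * 𝟙 (E x y)) + sum (λ y → 𝟙 (C y) * 𝟙 (E x y)))
      ≡⟨ ∑-distrib-+ (λ x → sum (λ y → 𝟙 (C x) * 𝟙 (E x y)))
                     (λ x → sum (λ y → 𝟙 (C y) * 𝟙 (E x y))) ⟩
    sum (λ x → sum (λ y → 𝟙 (C x) * 𝟙 (E x y))) + sum (λ x → sum (λ y → 𝟙 (C y) * 𝟙 (E x y)))
      ≡⟨ cong (sum (λ x → sum (λ y → 𝟙 (C x) * 𝟙 (E x y))) +_) swap-ends ⟩
    sum (λ x → sum (λ y → 𝟙 (C x) * 𝟙 (E x y))) + sum (λ x → sum (λ y → 𝟙 (C x) * 𝟙 (E x y)))
      ≡⟨ cong₂ _+_ pull-out (trans pull-out (sym (+-identityʳ _))) ⟩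
    2 * sum (λ x → 𝟙 (C x) * degree x) ∎
    where
    open ≤-Reasoning
    swap-ends : sum (λ x → sum (λ y → 𝟙 (C y) * 𝟙 (E x y)))
              ≡ sum (λ x → sum (λ y → 𝟙 (C x) * 𝟙 (E x y)))
    swap-ends = trans (∑-comm (λ x y → 𝟙 (C y) * 𝟙 (E x y)))
                      (sum-cong-≗ (λ x → sum-cong-≗ (λ y → cong (λ e → 𝟙 (C x) * 𝟙 e) (E-sym y x))))
    pull-out : sum (λ x → sum (λ y → 𝟙 (C x) * 𝟙 (E x y))) ≡ sum (λ x → 𝟙 (C x) * degree x)
    pull-out = sum-cong-≗ (λ x → sym (*-distribˡ-sum (𝟙 (C x)) (λ y → 𝟙 (E x y))))

  edge≤degree : ∀ {x y} → E x y ≡ true → 1 ≤ degree x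
  edge≤degree {x} {y} e = subst (_≤ degree x) (cong 𝟙 e) (term≤sum (λ y → 𝟙 (E x y)) y)

  module Regular (V : Fin m → Bool) (r : ℕ) (regular : ∀ x → degree x ≡ 𝟙 (V x) * r) where

    edge⇒vertex : ∀ {x y} → E x y ≡ true → V x ≡ true
    edge⇒vertex {x} e with V x in Vx
    ... | true  = refl
    ... | false with ≤-trans (edge≤degree e) (≤-reflexive (trans (regular x) (cong (λ b → 𝟙 b * r) Vx)))
    ...   | ()

    edge⇒NonZero : ∀ {x y} → E x y ≡ true → NonZero r
    edge⇒NonZero {x} e = >-nonZero (≤-trans (edge≤degree e) (≤-reflexive
      (trans (regular x) (trans (cong (λ b → 𝟙 b * r) (edge⇒vertex e)) (*-identityˡ r)))))

    degree≤r : ∀ x → degree x ≤ r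
    degree≤r x = ≤-trans (≤-reflexive (regular x))
                         (≤-trans (*-monoˡ-≤ r (𝟙≤1 (V x))) (≤-reflexive (*-identityˡ r)))

    cover-bound : .{{_ : NonZero r}} → ∀ C → Covers C → count V ≤ 2 * count C
    cover-bound C cov = *-cancelʳ-≤ (count V) (2 * count C) r (begin
      count V * r                        ≡⟨ *-distribʳ-sum r (𝟙 ∘ V) ⟩
      sum (λ x → 𝟙 (V x) * r)            ≡⟨ sum-cong-≗ regular ⟨
      sum degree                         ≤⟨ handshake-cover C cov ⟩
      2 * sum (λ x → 𝟙 (C x) * degree x) ≤⟨ *-monoʳ-≤ 2 (sum-mono-≤ λ x → *-monoʳ-≤ (𝟙 (C x)) (degree≤r x)) ⟩
      2 * sum (λ x → 𝟙 (C x) * r)        ≡⟨ cong (2 *_) (*-distribʳ-sum r (𝟙 ∘ C)) ⟨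
      2 * (count C * r)                  ≡⟨ *-assoc 2 (count C) r ⟨
      2 * count C * r                    ∎)
      where open ≤-Reasoning

    colour-class-covers : (col : Fin m → Bool) → (∀ x y → E x y ≡ true → col x ≢ col y) →
                          Covers (λ x → V x ∧ col x)
    colour-class-covers col proper x y e with col x in cx
    ... | true  = inj₁ (cong (_∧ true) (edge⇒vertex e))
    ... | false with col y in cy
    ...   | true  = inj₂ (cong (_∧ true) (edge⇒vertex (trans (E-sym y x) e)))
    ...   | false = ⊥-elim (proper x y e (trans cx (sym cy)))

    bipartite-half : .{{_ : NonZero r}} → (col : Fin m → Bool) → (∀ x y → E x y ≡ true → col x ≢ col y) →
                     2 * count (λ x → V x ∧ col x) ≡ count V
    bipartite-half col proper = balanced-split {count (λ x → V x ∧ col x)} {count (λ x → V x ∧ not (col x))}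
      (cover-bound (λ x → V x ∧ col x) (colour-class-covers col proper))
      (cover-bound (λ x → V x ∧ not (col x))
                   (colour-class-covers (not ∘ col) (λ x y e → proper x y e ∘ not-injective)))
      (sym (count-split V col))

least-witness : ∀ {P : ℕ → Set} → (∀ m → Dec (P m)) → ∀ {n} → P n →
                ∃ λ k → P k × (∀ j → j < k → ¬ P j)
least-witness {P} P? {n} pn = [ id , (λ none → contradiction pn (none n ≤-refl)) ]′ (scan (suc n))
  where
  scan : ∀ m → (∃ λ k → P k × (∀ j → j < k → ¬ P j)) ⊎ (∀ j → j < m → ¬ P j)
  scan zero = inj₂ λ _ ()
  scan (suc m) with scan m
  ... | inj₁ found = inj₁ found
  ... | inj₂ none with P? m
  ...   | yes pm = inj₁ (m , pm , none)
  ...   | no ¬pm = inj₂ λ j j<1+m → [ none j , (λ { refl → ¬pm }) ]′ (m<1+n⇒m<n∨m≡n j<1+m)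

argmax-Fin : ∀ {m} {P : Fin m → Set} → Decidable P → (f : Fin m → ℕ) → ∃ P →
             ∃ λ x → P x × (∀ y → P y → f y ≤ f x)
argmax-Fin {m} {P} P? f (x₀ , px₀) =
  best , argmax-all f px₀ (all-filter P? (allFin m)) ,
  λ y py → All.lookup (f[xs]≤f[argmax] x₀ candidates) (∈-filter⁺ P? (∈-allFin y) py)
  where
  candidates : List (Fin m)
  candidates = filter P? (allFin m)
  best : Fin m
  best = argmax f x₀ candidates

module Metric (G : Graph) (adj? : ∀ u v → Dec (Adj G u v)) (connected : Connected G) where

  private
    V : Set
    V = Fin (n G)

  _++ʷ_ : ∀ {u v w a b} → Walk G u v a → Walk G v w b → Walk G u w (a + b)
  here     ++ʷ q = q
  step h p ++ʷ q = step h (p ++ʷ q)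

  reverseʷ : ∀ {u v k} → Walk G u v k → Walk G v u k
  reverseʷ here = here
  reverseʷ {k = suc k} (step h p) =
    subst (Walk G _ _) (+-comm k 1) (reverseʷ p ++ʷ step (adj-sym G h) here)

  walk-length-0⇒≡ : ∀ {u v} → Walk G u v 0 → u ≡ v
  walk-length-0⇒≡ here = refl

  walk? : ∀ u v k → Dec (Walk G u v k)
  walk? u v zero with u ≟ v
  ... | yes refl = yes here
  ... | no u≢v   = no (u≢v ∘′ walk-length-0⇒≡)
  walk? u v (suc k) with any? (λ w → adj? u w ×-dec walk? w v k)
  ... | yes (w , h , p) = yes (step h p)
  ... | no ∄w           = no λ { (step h p) → ∄w (_ , h , p) }

  abstract
    shortest-walk : ∀ u v → ∃ (Dist G u v)
    shortest-walk u v = least-witness (walk? u v) (proj₂ (connected u v))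

  dist : V → V → ℕ
  dist u v = proj₁ (shortest-walk u v)

  dist-isDist : ∀ u v → Dist G u v (dist u v)
  dist-isDist u v = proj₂ (shortest-walk u v)

  geodesic : ∀ u v → Walk G u v (dist u v)
  geodesic u v = proj₁ (dist-isDist u v)

  dist≤length : ∀ {u v k} → Walk G u v k → dist u v ≤ k
  dist≤length {u} {v} {k} p = ≮⇒≥ λ k<dist → proj₂ (dist-isDist u v) k k<dist p

  Dist⇒≡dist : ∀ {u v k} → Dist G u v k → k ≡ dist u v
  Dist⇒≡dist {u} {v} (p , shortest) =
    ≤-antisym (≮⇒≥ λ dist<k → shortest (dist u v) dist<k (geodesic u v)) (dist≤length p)

  dist-triangle : ∀ u v w → dist u w ≤ dist u v + dist v w
  dist-triangle u v w = dist≤length (geodesic u v ++ʷ geodesic v w)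

  dist-sym : ∀ u v → dist u v ≡ dist v u
  dist-sym u v = ≤-antisym (dist≤length (reverseʷ (geodesic v u))) (dist≤length (reverseʷ (geodesic u v)))

  dist-refl : ∀ u → dist u u ≡ 0
  dist-refl u = n≤0⇒n≡0 (dist≤length here)

  dist≡0⇒≡ : ∀ {u v} → dist u v ≡ 0 → u ≡ v
  dist≡0⇒≡ {u} {v} d≡0 = walk-length-0⇒≡ (subst (Walk G u v) d≡0 (geodesic u v))

  Adj⇒dist≤1 : ∀ {u w} → Adj G u w → dist u w ≤ 1
  Adj⇒dist≤1 h = dist≤length (step h here)

  dist-Adj-≤suc : ∀ {u w} v → Adj G u w → dist v w ≤ suc (dist v u)
  dist-Adj-≤suc {u} {w} v h = begin
    dist v w           ≤⟨ dist-triangle v u w ⟩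
    dist v u + dist u w ≤⟨ +-monoʳ-≤ (dist v u) (Adj⇒dist≤1 h) ⟩
    dist v u + 1       ≡⟨ +-comm (dist v u) 1 ⟩
    suc (dist v u)     ∎
    where open ≤-Reasoning

  dist-suc⇒Adj : ∀ {u v k} → dist u v ≡ suc k → ∃ λ w → Adj G u w × dist w v ≡ k
  dist-suc⇒Adj {u} {v} {k} d≡1+k with subst (Walk G u v) d≡1+k (geodesic u v)
  ... | step {w = w} h p = w , h , ≤-antisym (dist≤length p) k≤dist
    where
    k≤dist : k ≤ dist w v
    k≤dist = +-cancelˡ-≤ 1 _ _ (begin
      suc k               ≡⟨ d≡1+k ⟨
      dist u v            ≤⟨ dist-triangle u w v ⟩
      dist u w + dist w v ≤⟨ +-monoˡ-≤ (dist w v) (Adj⇒dist≤1 h) ⟩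
      suc (dist w v)      ∎)
      where open ≤-Reasoning

  Between : V → V → V → Set
  Between u v x = dist u x + dist x v ≡ dist u v

  InInterval⇒Between : ∀ {u v x} → InInterval G u v x → Between u v x
  InInterval⇒Between (a , b , ux , xv , uv) =
    trans (cong₂ _+_ (sym (Dist⇒≡dist ux)) (sym (Dist⇒≡dist xv))) (Dist⇒≡dist uv)

  Between⇒InInterval : ∀ {u v x} → Between u v x → InInterval G u v x
  Between⇒InInterval {u} {v} {x} between =
    dist u x , dist x v , dist-isDist u x , dist-isDist x v , subst (Dist G u v) (sym between) (dist-isDist u v)

  MaxFrom : V → V → Set
  MaxFrom u v = ∀ w → Adj G u w → dist v w ≤ dist u v

  Mutual : V → V → Set
  Mutual u v = MaxFrom u v × MaxFrom v u

  MaxDistantFrom⇒MaxFrom : ∀ {u v} → MaxDistantFrom G u v → MaxFrom u v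
  MaxDistantFrom⇒MaxFrom {u} {v} max w h = max w h (dist v w) (dist u v) (dist-isDist v w) (dist-isDist u v)

  MaxFrom⇒MaxDistantFrom : ∀ {u v} → MaxFrom u v → MaxDistantFrom G u v
  MaxFrom⇒MaxDistantFrom max w h a b vw uv = subst₂ _≤_ (sym (Dist⇒≡dist vw)) (sym (Dist⇒≡dist uv)) (max w h)

  MutuallyMaxDistant⇒Mutual : ∀ {u v} → MutuallyMaxDistant G u v → Mutual u v
  MutuallyMaxDistant⇒Mutual (uv , vu) = MaxDistantFrom⇒MaxFrom uv , MaxDistantFrom⇒MaxFrom vu

  Mutual⇒MutuallyMaxDistant : ∀ {u v} → Mutual u v → MutuallyMaxDistant G u v
  Mutual⇒MutuallyMaxDistant (uv , vu) = MaxFrom⇒MaxDistantFrom uv , MaxFrom⇒MaxDistantFrom vu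

  maxFrom? : ∀ u v → Dec (MaxFrom u v)
  maxFrom? u v = all? λ w → adj? u w →-dec (dist v w ≤? dist u v)

  mutual? : ∀ u v → Dec (Mutual u v)
  mutual? u v = maxFrom? u v ×-dec maxFrom? v u

  maxFrom-geodesic-end : ∀ {x y w} → MaxFrom y x → Between x w y → y ≡ w
  maxFrom-geodesic-end {x} {y} {w} y-max between with dist y w in yw
  ... | zero  = dist≡0⇒≡ yw
  ... | suc k with dist-suc⇒Adj yw
  ...   | z , y~z , zw = contradiction (+-cancelˡ-≤ (dist x y) _ _ beyond) 1+n≰n
    where
    open ≤-Reasoning
    beyond : dist x y + suc k ≤ dist x y + k
    beyond = begin
      dist x y + suc k    ≡⟨ between ⟩
      dist x w            ≤⟨ dist-triangle x z w ⟩
      dist x z + dist z w ≤⟨ +-monoˡ-≤ (dist z w) (y-max z y~z) ⟩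
      dist y x + dist z w ≡⟨ cong₂ _+_ (dist-sym y x) zw ⟩
      dist x y + k        ∎

  strongResolving⇒covers : ∀ {S} → StrongResolvingSet G S → ∀ x y → Mutual x y → x ∈ S ⊎ y ∈ S
  strongResolving⇒covers {S} resolving x y (x-max , y-max) with resolving x y
  ... | w , w∈S , inj₁ y∈I[x,w] =
    inj₂ (subst (_∈ S) (sym (maxFrom-geodesic-end y-max (InInterval⇒Between y∈I[x,w]))) w∈S)
  ... | w , w∈S , inj₂ x∈I[y,w] =
    inj₁ (subst (_∈ S) (sym (maxFrom-geodesic-end x-max (InInterval⇒Between x∈I[y,w]))) w∈S)

  -- z maximises dist p z among the z with q on a geodesic p–z.
  furthest-beyond : ∀ p q → ∃ λ z → Between p z q × MaxFrom z p
  furthest-beyond p q with argmax-Fin (λ z → dist p q + dist q z ℕ.≟ dist p z) (dist p)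
                                      (q , trans (cong (dist p q +_) (dist-refl q)) (+-identityʳ _))
  ... | z , q-between , furthest = z , q-between , z-max
    where
    z-max : MaxFrom z p
    z-max w h with dist p w ≤? dist p z
    ... | yes pw≤pz = ≤-trans pw≤pz (≤-reflexive (dist-sym p z))
    ... | no  pw≰pz = contradiction (furthest w (≤-antisym pq+qw≤pw (dist-triangle p q w))) (<⇒≱ (≰⇒> pw≰pz))
      where
      open ≤-Reasoning
      pq+qw≤pw : dist p q + dist q w ≤ dist p w
      pq+qw≤pw = begin
        dist p q + dist q w       ≤⟨ +-monoʳ-≤ (dist p q) (dist-Adj-≤suc q h) ⟩
        dist p q + suc (dist q z) ≡⟨ +-suc (dist p q) (dist q z) ⟩
        suc (dist p q + dist q z) ≡⟨ cong suc q-between ⟩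
        suc (dist p z)            ≤⟨ ≰⇒> pw≰pz ⟩
        dist p w                  ∎

  mutual-resolvers : ∀ u v → ∃₂ λ x y → Mutual x y × StronglyResolves G x u v × StronglyResolves G y u v
  mutual-resolvers u v with furthest-beyond u v
  ... | x , v-between , x-max with furthest-beyond x u
  ...   | y , u-between , y-max =
    x , y , (x-max-y , y-max) , inj₁ (Between⇒InInterval v-between) , inj₂ (Between⇒InInterval u-between′)
    where
    open ≤-Reasoning
    x-max-y : MaxFrom x y
    x-max-y w h = begin
      dist y w            ≤⟨ dist-triangle y u w ⟩
      dist y u + dist u w ≤⟨ +-monoʳ-≤ (dist y u) (x-max w h) ⟩
      dist y u + dist x u ≡⟨ +-comm (dist y u) (dist x u) ⟩
      dist x u + dist y u ≡⟨ cong (dist x u +_) (dist-sym y u) ⟩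
      dist x u + dist u y ≡⟨ u-between ⟩
      dist x y            ∎
    u-between′ : Between v y u
    u-between′ = ≤-antisym (+-cancelˡ-≤ (dist v x) _ _ (begin
      dist v x + (dist v u + dist u y) ≡⟨ +-assoc (dist v x) (dist v u) (dist u y) ⟨
      dist v x + dist v u + dist u y   ≡⟨ cong (_+ dist u y) (+-comm (dist v x) (dist v u)) ⟩
      dist v u + dist v x + dist u y   ≡⟨ cong (λ d → d + dist v x + dist u y) (dist-sym v u) ⟩
      dist u v + dist v x + dist u y   ≡⟨ cong (_+ dist u y) (trans v-between (dist-sym u x)) ⟩
      dist x u + dist u y              ≡⟨ u-between ⟩
      dist x y                         ≤⟨ dist-triangle x v y ⟩
      dist x v + dist v y              ≡⟨ cong (_+ dist v y) (dist-sym x v) ⟩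
      dist v x + dist v y              ∎)) (dist-triangle v u y)

  covers⇒strongResolving : ∀ {S} → (∀ x y → Mutual x y → x ∈ S ⊎ y ∈ S) → StrongResolvingSet G S
  covers⇒strongResolving {S} cover u v =
    resolve (mutual-resolvers u v)
    where
    resolve : (∃₂ λ x y → Mutual x y × StronglyResolves G x u v × StronglyResolves G y u v) →
              ∃ λ w → w ∈ S × StronglyResolves G w u v
    resolve (x , y , xy-mutual , x-resolves , y-resolves) =
      [ (λ x∈S → x , x∈S , x-resolves) , (λ y∈S → y , y∈S , y-resolves) ]′ (cover x y xy-mutual)

  module _ (two : 2 ≤ n G) where

    private
      v₀ v₁ : V
      v₀ = fromℕ< {0} (≤-trans (s≤s z≤n) two)
      v₁ = fromℕ< {1} two

    another-vertex : ∀ x → ∃ λ y → x ≢ y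
    another-vertex x with x ≟ v₀
    ... | yes refl = v₁ , 0≢1+n ∘′ fromℕ<-injective 0 1 (≤-trans (s≤s z≤n) two) two
    ... | no x≢v₀  = v₀ , x≢v₀

    has-neighbour : ∀ x → ∃ (Adj G x)
    has-neighbour x with another-vertex x
    ... | y , x≢y with dist x y in xy
    ...   | zero  = contradiction (dist≡0⇒≡ xy) x≢y
    ...   | suc k = let w , x~w , _ = dist-suc⇒Adj xy in w , x~w

    mutual-irrefl : ∀ x → ¬ Mutual x x
    mutual-irrefl x (x-max , _) with has-neighbour x
    ... | w , h = irrefl G (subst (Adj G x) (sym (dist≡0⇒≡ xw≡0)) h)
      where
      xw≡0 : dist x w ≡ 0
      xw≡0 = n≤0⇒n≡0 (≤-trans (x-max w h) (≤-reflexive (dist-refl x)))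

module StrongResolvingGraph (G : Graph) (adj? : ∀ u v → Dec (Adj G u v)) (connected : Connected G)
                            (two : 2 ≤ n G) (B : Subset (n G)) (isB : IsBoundary G B) where

  open Metric G adj? connected public

  E : Fin (n G) → Fin (n G) → Bool
  E u v = does (mutual? u v)

  E-sym : ∀ u v → E u v ≡ E v u
  E-sym u v = does-⇔ (mk⇔ swap swap) (mutual? u v) (mutual? v u)

  open BooleanGraph E E-sym public

  E⇒Mutual : ∀ {u v} → E u v ≡ true → Mutual u v
  E⇒Mutual {u} {v} = does≡true⇒ (mutual? u v)

  Mutual⇒E : ∀ {u v} → Mutual u v → E u v ≡ true
  Mutual⇒E {u} {v} = dec-true (mutual? u v)

  ∈B⇒InBoundary : ∀ {u} → lookup B u ≡ true → InBoundary G u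
  ∈B⇒InBoundary {u} u∈B = Equivalence.to (isB u) (lookup⇒[]= u B u∈B)

  Mutual⇒∈B : ∀ {u v} → Mutual u v → lookup B u ≡ true
  Mutual⇒∈B {u} {v} uv = []=⇒lookup (Equivalence.from (isB u) (v , Mutual⇒MutuallyMaxDistant uv))

  Mutual⇒SRAdj : ∀ {u v} → Mutual u v → SRAdj G u v
  Mutual⇒SRAdj {u} {v} uv =
    ∈B⇒InBoundary (Mutual⇒∈B uv) , ∈B⇒InBoundary (Mutual⇒∈B (swap uv)) ,
    (λ { refl → mutual-irrefl two u uv }) , Mutual⇒MutuallyMaxDistant uv

  SRAdj⇒Mutual : ∀ {u v} → SRAdj G u v → Mutual u v
  SRAdj⇒Mutual (_ , _ , _ , uv) = MutuallyMaxDistant⇒Mutual uv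

  degree-regular : ((r , _) : SRRegular G) → ∀ u → degree u ≡ 𝟙 (lookup B u) * r
  degree-regular (r , regular) u with lookup B u in u∈B
  ... | false = trans (sum-cong-≗ no-edge) (sum-replicate-zero (n G))
    where
    no-edge : ∀ v → 𝟙 (E u v) ≡ 0
    no-edge v = cong 𝟙 (does-reflects (mutual? u v) (λ uv → trans (sym u∈B) (Mutual⇒∈B uv)) λ ())
  ... | true with regular u (∈B⇒InBoundary u∈B)
  ...   | N , N≡SRAdj , ∣N∣≡r = begin
    count (E u)     ≡⟨ sum-cong-≗ (λ v → cong 𝟙 (does-reflects (mutual? u v) (N-edge v) (edge-N v))) ⟩
    count (lookup N) ≡⟨ ∣p∣≡count-lookup N ⟨
    ∣ N ∣           ≡⟨ ∣N∣≡r ⟩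
    r               ≡⟨ +-identityʳ r ⟨
    1 * r           ∎
    where
    open ≡-Reasoning
    N-edge : ∀ v → Mutual u v → lookup N v ≡ true
    N-edge v uv = []=⇒lookup (Equivalence.from (N≡SRAdj v) (Mutual⇒SRAdj uv))
    edge-N : ∀ v → lookup N v ≡ true → Mutual u v
    edge-N v v∈N = SRAdj⇒Mutual (Equivalence.to (N≡SRAdj v) (lookup⇒[]= v N v∈N))

  module SR-Regular (reg : SRRegular G) = Regular (lookup B) (proj₁ reg) (degree-regular reg)

  SR-nonZero : (reg : SRRegular G) → NonZero (proj₁ reg)
  SR-nonZero reg =
    let x , y , xy-mutual , _ = mutual-resolvers (fromℕ< two) (fromℕ< two)
    in SR-Regular.edge⇒NonZero reg (Mutual⇒E xy-mutual)

  HalfCover : Set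
  HalfCover = ∃ λ C → (∀ u v → Mutual u v → C u ≡ true ⊎ C v ≡ true) × 2 * count C ≡ ∣ B ∣

  bipartite-half-cover : SRRegular G → SRBipartite G → HalfCover
  bipartite-half-cover reg (col , proper) =
    (λ u → lookup B u ∧ col u) ,
    (λ u v → colour-class-covers col proper′ u v ∘ Mutual⇒E) ,
    trans (bipartite-half {{SR-nonZero reg}} col proper′) (sym (∣p∣≡count-lookup B))
    where
    open SR-Regular reg
    proper′ : ∀ u v → E u v ≡ true → col u ≢ col v
    proper′ u v = proper u v ∘ Mutual⇒SRAdj ∘ E⇒Mutual

module Product (G H : Graph) (adjG? : ∀ u v → Dec (Adj G u v)) (adjH? : ∀ u v → Dec (Adj H u v))
               (connG : Connected G) (connH : Connected H) where

  private
    P : Graph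
    P = G □ H

  π₁ : Fin (n G * n H) → Fin (n G)
  π₁ x = proj₁ (remQuot {n G} (n H) x)

  π₂ : Fin (n G * n H) → Fin (n H)
  π₂ x = proj₂ (remQuot {n G} (n H) x)

  π₁-combine : ∀ a b → π₁ (combine a b) ≡ a
  π₁-combine a b = cong proj₁ (remQuot-combine {n G} {n H} a b)

  π₂-combine : ∀ a b → π₂ (combine a b) ≡ b
  π₂-combine a b = cong proj₂ (remQuot-combine {n G} {n H} a b)

  combine-π : ∀ x → combine (π₁ x) (π₂ x) ≡ x
  combine-π x = combine-remQuot {n G} (n H) x

  sum-□ : (f : Fin (n G) → ℕ) (g : Fin (n H) → ℕ) → sum (λ x → f (π₁ x) * g (π₂ x)) ≡ sum f * sum g
  sum-□ f g = begin
    sum (λ x → f (π₁ x) * g (π₂ x))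
      ≡⟨ sum-combine (n G) {n H} (λ x → f (π₁ x) * g (π₂ x)) ⟩
    sum {n G} (λ a → sum {n H} (λ b → f (π₁ (combine a b)) * g (π₂ (combine a b))))
      ≡⟨ sum-cong-≗ (λ a → sum-cong-≗ λ b → cong₂ _*_ (cong f (π₁-combine a b)) (cong g (π₂-combine a b))) ⟩
    sum (λ a → sum (λ b → f a * g b))                        ≡⟨ sum-cong-≗ (λ a → *-distribˡ-sum (f a) g) ⟨
    sum (λ a → f a * sum g)                                  ≡⟨ *-distribʳ-sum (sum g) f ⟨
    sum f * sum g                                            ∎
    where open ≡-Reasoning

  adj□? : ∀ x y → Dec (Adj P x y)
  adj□? x y = ((π₁ x ≟ π₁ y) ×-dec adjH? (π₂ x) (π₂ y))
        ⊎-dec ((π₂ x ≟ π₂ y) ×-dec adjG? (π₁ x) (π₁ y))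

  horizontal : ∀ {a a′} b → Adj G a a′ → Adj P (combine a b) (combine a′ b)
  horizontal {a} {a′} b h =
    subst₂ (PAdj G H) (sym (remQuot-combine {n G} {n H} a b)) (sym (remQuot-combine {n G} {n H} a′ b))
           (inj₂ (refl , h))

  vertical : ∀ a {b b′} → Adj H b b′ → Adj P (combine a b) (combine a b′)
  vertical a {b} {b′} h =
    subst₂ (PAdj G H) (sym (remQuot-combine {n G} {n H} a b)) (sym (remQuot-combine {n G} {n H} a b′))
           (inj₁ (refl , h))

  horizontalʷ : ∀ {a a′ k} → Walk G a a′ k → ∀ b → Walk P (combine a b) (combine a′ b) k
  horizontalʷ here       b = here
  horizontalʷ (step h p) b = step (horizontal b h) (horizontalʷ p b)

  verticalʷ : ∀ a {b b′ k} → Walk H b b′ k → Walk P (combine a b) (combine a b′) k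
  verticalʷ a here       = here
  verticalʷ a (step h p) = step (vertical a h) (verticalʷ a p)

  _++□_ : ∀ {u v w a b} → Walk P u v a → Walk P v w b → Walk P u w (a + b)
  here     ++□ q = q
  step h p ++□ q = step h (p ++□ q)

  pairʷ : ∀ {x y k l} → Walk G (π₁ x) (π₁ y) k → Walk H (π₂ x) (π₂ y) l → Walk P x y (k + l)
  pairʷ {x} {y} {k} {l} p q =
    subst₂ (λ s t → Walk P s t (k + l)) (combine-π x) (combine-π y) (horizontalʷ p (π₂ x) ++□ verticalʷ (π₁ y) q)

  projʷ : ∀ {x y k} → Walk P x y k →
          ∃₂ λ k₁ k₂ → k₁ + k₂ ≡ k × Walk G (π₁ x) (π₁ y) k₁ × Walk H (π₂ x) (π₂ y) k₂
  projʷ here = 0 , 0 , refl , here , here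
  projʷ (step (inj₁ (same , h)) p) with projʷ p
  ... | k₁ , k₂ , refl , p₁ , p₂ =
    k₁ , suc k₂ , +-suc k₁ k₂ , subst (λ a → Walk G a _ _) (sym same) p₁ , step h p₂
  projʷ (step (inj₂ (same , g)) p) with projʷ p
  ... | k₁ , k₂ , refl , p₁ , p₂ =
    suc k₁ , k₂ , refl , step g p₁ , subst (λ b → Walk H b _ _) (sym same) p₂

  connected□ : Connected P
  connected□ x y = _ , pairʷ (proj₂ (connG (π₁ x) (π₁ y))) (proj₂ (connH (π₂ x) (π₂ y)))

  module MG = Metric G adjG? connG
  module MH = Metric H adjH? connH
  module MP = Metric P adj□? connected□

  dist-□ : ∀ x y → MP.dist x y ≡ MG.dist (π₁ x) (π₁ y) + MH.dist (π₂ x) (π₂ y)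
  dist-□ x y = sym (MP.Dist⇒≡dist (pairʷ (MG.geodesic _ _) (MH.geodesic _ _) , no-shorter))
    where
    no-shorter : ∀ m → m < MG.dist (π₁ x) (π₁ y) + MH.dist (π₂ x) (π₂ y) → ¬ Walk P x y m
    no-shorter m m<d p with projʷ p
    ... | k₁ , k₂ , refl , p₁ , p₂ = <⇒≱ m<d (+-mono-≤ (MG.dist≤length p₁) (MH.dist≤length p₂))

  MaxFrom-□⇒G : ∀ {x y} → MP.MaxFrom x y → MG.MaxFrom (π₁ x) (π₁ y)
  MaxFrom-□⇒G {x} {y} x-max a′ h = +-cancelʳ-≤ (MH.dist (π₂ x) (π₂ y)) _ _ (begin
    MG.dist (π₁ y) a′ + MH.dist (π₂ x) (π₂ y)
      ≡⟨ cong₂ _+_ (cong (MG.dist (π₁ y)) (sym (π₁-combine a′ (π₂ x))))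
                   (trans (MH.dist-sym (π₂ x) (π₂ y)) (cong (MH.dist (π₂ y)) (sym (π₂-combine a′ (π₂ x))))) ⟩
    MG.dist (π₁ y) (π₁ z) + MH.dist (π₂ y) (π₂ z) ≡⟨ dist-□ y z ⟨
    MP.dist y z                                   ≤⟨ x-max z x~z ⟩
    MP.dist x y                                   ≡⟨ dist-□ x y ⟩
    MG.dist (π₁ x) (π₁ y) + MH.dist (π₂ x) (π₂ y) ∎)
    where
    open ≤-Reasoning
    z = combine a′ (π₂ x)
    x~z : Adj P x z
    x~z = inj₂ (sym (π₂-combine a′ (π₂ x)) , subst (Adj G (π₁ x)) (sym (π₁-combine a′ (π₂ x))) h)

  MaxFrom-□⇒H : ∀ {x y} → MP.MaxFrom x y → MH.MaxFrom (π₂ x) (π₂ y)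
  MaxFrom-□⇒H {x} {y} x-max b′ h = +-cancelˡ-≤ (MG.dist (π₁ x) (π₁ y)) _ _ (begin
    MG.dist (π₁ x) (π₁ y) + MH.dist (π₂ y) b′
      ≡⟨ cong₂ _+_ (trans (MG.dist-sym (π₁ x) (π₁ y)) (cong (MG.dist (π₁ y)) (sym (π₁-combine (π₁ x) b′))))
                   (cong (MH.dist (π₂ y)) (sym (π₂-combine (π₁ x) b′))) ⟩
    MG.dist (π₁ y) (π₁ z) + MH.dist (π₂ y) (π₂ z) ≡⟨ dist-□ y z ⟨
    MP.dist y z                                   ≤⟨ x-max z x~z ⟩
    MP.dist x y                                   ≡⟨ dist-□ x y ⟩
    MG.dist (π₁ x) (π₁ y) + MH.dist (π₂ x) (π₂ y) ∎)
    where
    open ≤-Reasoning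
    z = combine (π₁ x) b′
    x~z : Adj P x z
    x~z = inj₁ (sym (π₁-combine (π₁ x) b′) , subst (Adj H (π₂ x)) (sym (π₂-combine (π₁ x) b′)) h)

  MaxFrom×⇒MaxFrom-□ : ∀ {x y} → MG.MaxFrom (π₁ x) (π₁ y) → MH.MaxFrom (π₂ x) (π₂ y) → MP.MaxFrom x y
  MaxFrom×⇒MaxFrom-□ {x} {y} maxG maxH w x~w = begin
    MP.dist y w                                   ≡⟨ dist-□ y w ⟩
    MG.dist (π₁ y) (π₁ w) + MH.dist (π₂ y) (π₂ w) ≤⟨ factorwise x~w ⟩
    MG.dist (π₁ x) (π₁ y) + MH.dist (π₂ x) (π₂ y) ≡⟨ dist-□ x y ⟨
    MP.dist x y                                   ∎
    where
    open ≤-Reasoning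
    factorwise : Adj P x w →
                 MG.dist (π₁ y) (π₁ w) + MH.dist (π₂ y) (π₂ w) ≤ MG.dist (π₁ x) (π₁ y) + MH.dist (π₂ x) (π₂ y)
    factorwise (inj₁ (same , h)) =
      +-mono-≤ (≤-reflexive (trans (cong (MG.dist (π₁ y)) (sym same)) (MG.dist-sym _ _))) (maxH _ h)
    factorwise (inj₂ (same , g)) =
      +-mono-≤ (maxG _ g) (≤-reflexive (trans (cong (MH.dist (π₂ y)) (sym same)) (MH.dist-sym _ _)))

  Mutual-□⇒Mutual× : ∀ {x y} → MP.Mutual x y → MG.Mutual (π₁ x) (π₁ y) × MH.Mutual (π₂ x) (π₂ y)
  Mutual-□⇒Mutual× (xy , yx) = (MaxFrom-□⇒G xy , MaxFrom-□⇒G yx) , (MaxFrom-□⇒H xy , MaxFrom-□⇒H yx)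

  Mutual×⇒Mutual-□ : ∀ {x y} → MG.Mutual (π₁ x) (π₁ y) → MH.Mutual (π₂ x) (π₂ y) → MP.Mutual x y
  Mutual×⇒Mutual-□ (xyG , yxG) (xyH , yxH) = MaxFrom×⇒MaxFrom-□ xyG xyH , MaxFrom×⇒MaxFrom-□ yxG yxH

  count-□ : (f : Fin (n G) → Bool) (g : Fin (n H) → Bool) →
            count (λ x → f (π₁ x) ∧ g (π₂ x)) ≡ count f * count g
  count-□ f g = trans (sum-cong-≗ λ x → 𝟙-∧ (f (π₁ x)) (g (π₂ x))) (sum-□ (𝟙 ∘ f) (𝟙 ∘ g))

module Theorem (G H : Graph) (adjG? : ∀ u v → Dec (Adj G u v)) (adjH? : ∀ u v → Dec (Adj H u v))
               (connG : Connected G) (connH : Connected H) (twoG : 2 ≤ n G) (twoH : 2 ≤ n H)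
               (BG : Subset (n G)) (isBG : IsBoundary G BG) (BH : Subset (n H)) (isBH : IsBoundary H BH)
               (regG : SRRegular G) (regH : SRRegular H) where

  module SG = StrongResolvingGraph G adjG? connG twoG BG isBG
  module SH = StrongResolvingGraph H adjH? connH twoH BH isBH
  open Product G H adjG? adjH? connG connH

  E□ : Fin (n G * n H) → Fin (n G * n H) → Bool
  E□ x y = SG.E (π₁ x) (π₁ y) ∧ SH.E (π₂ x) (π₂ y)

  B□ : Fin (n G * n H) → Bool
  B□ x = lookup BG (π₁ x) ∧ lookup BH (π₂ x)

  E□-sym : ∀ x y → E□ x y ≡ E□ y x
  E□-sym x y = cong₂ _∧_ (SG.E-sym (π₁ x) (π₁ y)) (SH.E-sym (π₂ x) (π₂ y))

  open BooleanGraph E□ E□-sym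

  rG rH : ℕ
  rG = proj₁ regG
  rH = proj₁ regH

  degree-□ : ∀ x → degree x ≡ 𝟙 (B□ x) * (rG * rH)
  degree-□ x = begin
    degree x                              ≡⟨ count-□ (SG.E (π₁ x)) (SH.E (π₂ x)) ⟩
    SG.degree (π₁ x) * SH.degree (π₂ x)   ≡⟨ cong₂ _*_ (SG.degree-regular regG (π₁ x)) (SH.degree-regular regH (π₂ x)) ⟩
    𝟙 (bG x) * rG * (𝟙 (bH x) * rH)       ≡⟨ *-interchange (𝟙 (bG x)) rG (𝟙 (bH x)) rH ⟩
    𝟙 (bG x) * 𝟙 (bH x) * (rG * rH)       ≡⟨ cong (_* (rG * rH)) (𝟙-∧ (bG x) (bH x)) ⟨
    𝟙 (B□ x) * (rG * rH)                  ∎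
    where
    open ≡-Reasoning
    bG bH : Fin (n G * n H) → Bool
    bG x = lookup BG (π₁ x)
    bH x = lookup BH (π₂ x)

  ∣BG∣*∣BH∣≡count-B□ : ∣ BG ∣ * ∣ BH ∣ ≡ count B□
  ∣BG∣*∣BH∣≡count-B□ =
    trans (cong₂ _*_ (∣p∣≡count-lookup BG) (∣p∣≡count-lookup BH)) (sym (count-□ (lookup BG) (lookup BH)))

  E□⇒Mutual : ∀ {x y} → E□ x y ≡ true → MP.Mutual x y
  E□⇒Mutual e with ∧-≡true⁻ e
  ... | eG , eH = Mutual×⇒Mutual-□ (SG.E⇒Mutual eG) (SH.E⇒Mutual eH)

  lower-bound : ∀ S → StrongResolvingSet (G □ H) S → ∣ BG ∣ * ∣ BH ∣ ≤ 2 * ∣ S ∣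
  lower-bound S resolving = begin
    ∣ BG ∣ * ∣ BH ∣      ≡⟨ ∣BG∣*∣BH∣≡count-B□ ⟩
    count B□             ≤⟨ cover-bound {{rG*rH≢0}} (lookup S) S-covers ⟩
    2 * count (lookup S) ≡⟨ cong (2 *_) (∣p∣≡count-lookup S) ⟨
    2 * ∣ S ∣            ∎
    where
    open ≤-Reasoning
    open Regular B□ (rG * rH) degree-□
    rG*rH≢0 : NonZero (rG * rH)
    rG*rH≢0 = m*n≢0 rG rH {{SG.SR-nonZero regG}} {{SH.SR-nonZero regH}}
    S-covers : Covers (lookup S)
    S-covers x y e =
      Sum.map ([]=⇒lookup {i = x}) ([]=⇒lookup {i = y}) (MP.strongResolving⇒covers resolving x y (E□⇒Mutual e))

  dim≤count-cover : ∀ {k} → IsStrongMetricDim (G □ H) k → (C : Fin (n G * n H) → Bool) →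
                    (∀ x y → MP.Mutual x y → C x ≡ true ⊎ C y ≡ true) → k ≤ count C
  dim≤count-cover {k} (_ , minimal) C covers = begin
    k                           ≤⟨ minimal (tabulate C) (MP.covers⇒strongResolving λ x y → Sum.map ∈C ∈C ∘ covers x y) ⟩
    ∣ tabulate C ∣               ≡⟨ ∣p∣≡count-lookup (tabulate C) ⟩
    count (lookup (tabulate C)) ≡⟨ sum-cong-≗ (cong 𝟙 ∘ lookup∘tabulate C) ⟩
    count C                     ∎
    where
    open ≤-Reasoning
    ∈C : ∀ {x} → C x ≡ true → x ∈ tabulate C
    ∈C {x} Cx = lookup⇒[]= x (tabulate C) (trans (lookup∘tabulate C x) Cx)

  upper-bound-G : ∀ {k} → IsStrongMetricDim (G □ H) k → SG.HalfCover → 2 * k ≤ ∣ BG ∣ * ∣ BH ∣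
  upper-bound-G {k} dim (T , T-covers , 2∣T∣≡∣BG∣) = begin
    2 * k                                         ≤⟨ *-monoʳ-≤ 2 (dim≤count-cover dim C C-covers) ⟩
    2 * count C                                   ≡⟨ cong (2 *_) (count-□ T (lookup BH)) ⟩
    2 * (count T * count (lookup BH))             ≡⟨ *-assoc 2 (count T) _ ⟨
    2 * count T * count (lookup BH)               ≡⟨ cong₂ _*_ 2∣T∣≡∣BG∣ (sym (∣p∣≡count-lookup BH)) ⟩
    ∣ BG ∣ * ∣ BH ∣                               ∎
    where
    open ≤-Reasoning
    C : Fin (n G * n H) → Bool
    C x = T (π₁ x) ∧ lookup BH (π₂ x)
    C-covers : ∀ x y → MP.Mutual x y → C x ≡ true ⊎ C y ≡ true
    C-covers x y xy =
      let xyG , xyH = Mutual-□⇒Mutual× xy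
      in Sum.map (λ Tx → ∧-≡true⁺ Tx (SH.Mutual⇒∈B xyH)) (λ Ty → ∧-≡true⁺ Ty (SH.Mutual⇒∈B (swap xyH)))
                 (T-covers _ _ xyG)

  upper-bound-H : ∀ {k} → IsStrongMetricDim (G □ H) k → SH.HalfCover → 2 * k ≤ ∣ BG ∣ * ∣ BH ∣
  upper-bound-H {k} dim (T , T-covers , 2∣T∣≡∣BH∣) = begin
    2 * k                                         ≤⟨ *-monoʳ-≤ 2 (dim≤count-cover dim C C-covers) ⟩
    2 * count C                                   ≡⟨ cong (2 *_) (count-□ (lookup BG) T) ⟩
    2 * (count (lookup BG) * count T)             ≡⟨ *-comm 2 (count (lookup BG) * count T) ⟩
    count (lookup BG) * count T * 2               ≡⟨ *-assoc (count (lookup BG)) (count T) 2 ⟩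
    count (lookup BG) * (count T * 2)
      ≡⟨ cong₂ _*_ (sym (∣p∣≡count-lookup BG)) (trans (*-comm (count T) 2) 2∣T∣≡∣BH∣) ⟩
    ∣ BG ∣ * ∣ BH ∣                               ∎
    where
    open ≤-Reasoning
    C : Fin (n G * n H) → Bool
    C x = lookup BG (π₁ x) ∧ T (π₂ x)
    C-covers : ∀ x y → MP.Mutual x y → C x ≡ true ⊎ C y ≡ true
    C-covers x y xy =
      let xyG , xyH = Mutual-□⇒Mutual× xy
      in Sum.map (∧-≡true⁺ (SG.Mutual⇒∈B xyG)) (∧-≡true⁺ (SG.Mutual⇒∈B (swap xyG))) (T-covers _ _ xyH)

  strong-metric-dimension : ∀ {k} → IsStrongMetricDim (G □ H) k → SRBipartite G ⊎ SRBipartite H →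
                            2 * k ≡ ∣ BG ∣ * ∣ BH ∣
  strong-metric-dimension {k} dim@((S , resolving , ∣S∣≡k) , _) bipartite =
    ≤-antisym upper (subst (λ s → ∣ BG ∣ * ∣ BH ∣ ≤ 2 * s) ∣S∣≡k (lower-bound S resolving))
    where
    upper : 2 * k ≤ ∣ BG ∣ * ∣ BH ∣
    upper = [ upper-bound-G dim ∘ SG.bipartite-half-cover regG
            , upper-bound-H dim ∘ SH.bipartite-half-cover regH ]′ bipartite

¬¬-∀-Fin : ∀ {m} {P : Fin m → Set} → (∀ i → ¬ ¬ P i) → ¬ ¬ (∀ i → P i)
¬¬-∀-Fin {zero}      _   ¬all = ¬all λ ()
¬¬-∀-Fin {suc m} {P} ¬¬P ¬all =
  ¬¬P zero λ p₀ → ¬¬-∀-Fin {m} {P ∘ suc} (¬¬P ∘ suc) λ ps → ¬all λ { zero → p₀ ; (suc i) → ps i }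

¬¬-decidable-adjacency : ∀ G → ¬ ¬ (∀ u v → Dec (Adj G u v))
¬¬-decidable-adjacency G = ¬¬-∀-Fin λ u → ¬¬-∀-Fin λ v → ¬¬-excluded-middle

-- Adjacency in a Graph is an arbitrary relation, so its decidability, needed to compute distances,
-- holds only under double negation; that suffices because the conclusion is a decidable equation.
theorem10 : (G H : Graph) → 2 ≤ n G → 2 ≤ n H →
    Connected G → Connected H →
    SRRegular G → SRRegular H →
    (SRBipartite G ⊎ SRBipartite H) →
    (BG : Subset (n G)) → IsBoundary G BG →
    (BH : Subset (n H)) → IsBoundary H BH →
    (k : ℕ) → IsStrongMetricDim (G □ H) k →
    2 * k ≡ ∣ BG ∣ * ∣ BH ∣
theorem10 G H twoG twoH connG connH regG regH bipartite BG isBG BH isBH k dim =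
  decidable-stable (2 * k ℕ.≟ ∣ BG ∣ * ∣ BH ∣) λ 2k≢ →
    ¬¬-decidable-adjacency G λ adjG? → ¬¬-decidable-adjacency H λ adjH? →
      2k≢ (Theorem.strong-metric-dimension G H adjG? adjH? connG connH twoG twoH BG isBG BH isBH regG regH dim bipartite)
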